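{- Let $d\ge k\ge1$ and let $M$ be a $\binom{d}{k}$-ary tree. Then the number of non-ambiguous trees of dimension $(d,k)$ with underlying tree $M$ is $$|\mathrm{NAT}_{d,k}(M)|=\prod_{i=1}^d\frac{(w_i(M)-1)!}{\prod_{U} E_i(U)},$$ where for each $i$ the inner product runs over the non-root vertices $U$ of $M$ whose direction contains $i$.
   Context: A $k$-subset of $\{1,\dots,d\}$ is called a $(d,k)$-direction. A $\binom{d}{k}$-ary tree is a rooted tree in which each child of a vertex is indexed by a $(d,k)$-direction, distinct children of a same vertex having distinct indices; the direction of a non-root vertex is its index. For a vertex $U$ and $i\in\{1,\dots,d\}$, $E_i(U)$ is the number of vertices in the subtree rooted at $U$ ($U$ included) whose direction contains $i$. $w_i(M)=1+$ (number of non-root vertices of $M$ whose direction contains $i$). A non-ambiguous tree of dimension $(d,k)$ is a $\binom{d}{k}$-ary tree whose vertices carry labels in $(\mathbb{N}\cup\{\bullet\})^d$ such that: (1) a vertex of direction $\pi$ is labelled by a $d$-tuple whose non-$\bullet$ entries are exactly those in positions $i\in\pi$, and the root is labelled by a $d$-tuple with no $\bullet$; (2) if $U$ is a descendant of $V$ and the $i$-th components of $U$ and $V$ are both different from $\bullet$, then the $i$-th component of $V$ is strictly greater than that of $U$; (3) for each $i$, the $i$-th components different from $\bullet$ of all vertices are pairwise distinct and form an interval of integers with minimum $1$. $\mathrm{NAT}_{d,k}(M)$ is the set of such labellings of $M$. -}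

module Defs where

open import Data.Nat using (ℕ; zero; suc; _+_; _*_; _∸_; _≤_; _<_; _!)
open import Data.Bool using (Bool; true; false; if_then_else_)
open import Data.Fin using (Fin)
open import Data.Fin.Subset using (Subset; _∈_; ∣_∣)
open import Data.Maybe using (Maybe; just; nothing; Is-just)
open import Data.List using (List; []; _∷_; map; mapMaybe; allFin; _++_)
open import Data.Nat.ListAction using (product)
open import Data.List.Relation.Unary.All using (All)
open import Data.List.Relation.Unary.Unique.Propositional using (Unique)
import Data.List.Membership.Propositional as LMem
open import Data.Vec using (Vec; lookup)
open import Data.Product using (Σ; _×_; _,_; proj₁; proj₂; ∃)
open import Function.Bundles using (_⇔_)
open import Relation.Binary.PropositionalEquality using (_≡_)

-- A (d,k)-direction is a k-subset of {1,…,d}, encoded as a Subset d (Vec Bool d)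
-- of cardinality k; coordinate i ∈ {1..d} is encoded as Fin d.

-- Underlying (unlabelled) rooted tree: each vertex has a list of children,
-- each child tagged with its index (direction).
data Tree (d : ℕ) : Set where
  node : List (Subset d × Tree d) → Tree d

-- M is a binom(d,k)-ary tree: every index is a (d,k)-direction and distinct
-- children of a same vertex have distinct indices.
data IsTreeDK {d : ℕ} (k : ℕ) : Tree d → Set where
  node : ∀ {cs : List (Subset d × Tree d)} →
         All (λ c → ∣ proj₁ c ∣ ≡ k) cs →
         Unique (map proj₁ cs) →
         All (λ c → IsTreeDK k (proj₂ c)) cs →
         IsTreeDK k (node cs)

indic : ∀ {d} → Fin d → Subset d → ℕ
indic i π = if lookup π i then 1 else 0

mutual
  cnt : ∀ {d} → Fin d → Tree d → ℕ
  cnt i (node cs) = cntL i cs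

  cntL : ∀ {d} → Fin d → List (Subset d × Tree d) → ℕ
  cntL i [] = 0
  cntL i ((π , t) ∷ cs) = indic i π + cnt i t + cntL i cs

w : ∀ {d} → Fin d → Tree d → ℕ
w i M = 1 + cnt i M

-- For a non-root vertex U with direction π and subtree t below it,
-- E_i(U) = [i ∈ π] + cnt i t  (vertices of the subtree rooted at U, U included,
-- whose direction contains i).
mutual
  prodE : ∀ {d} → Fin d → Tree d → ℕ
  prodE i (node cs) = prodEL i cs

  prodEL : ∀ {d} → Fin d → List (Subset d × Tree d) → ℕ
  prodEL i [] = 1
  prodEL i ((π , t) ∷ cs) =
    (if lookup π i then 1 + cnt i t else 1) * prodE i t * prodEL i cs

-- Labelled trees: each vertex carries a label in (ℕ ∪ {•})^d,
-- • being represented by nothing.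
Label : ℕ → Set
Label d = Vec (Maybe ℕ) d

data LTree (d : ℕ) : Set where
  lnode : Label d → List (Subset d × LTree d) → LTree d

mutual
  shape : ∀ {d} → LTree d → Tree d
  shape (lnode l cs) = node (shapeL cs)

  shapeL : ∀ {d} → List (Subset d × LTree d) → List (Subset d × Tree d)
  shapeL [] = []
  shapeL ((π , t) ∷ cs) = (π , shape t) ∷ shapeL cs

mutual
  labels : ∀ {d} → LTree d → List (Label d)
  labels (lnode l cs) = l ∷ labelsL cs

  labelsL : ∀ {d} → List (Subset d × LTree d) → List (Label d)
  labelsL [] = []
  labelsL ((π , t) ∷ cs) = labels t ++ labelsL cs

rootLabel : ∀ {d} → LTree d → Label d
rootLabel (lnode l cs) = l

RootOK : ∀ {d} → LTree d → Set
RootOK {d} L = ∀ (i : Fin d) → Is-just (lookup (rootLabel L) i)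

data DirOK {d : ℕ} : LTree d → Set where
  lnode : ∀ {l cs} →
          All (λ c → (∀ (i : Fin d) → (Is-just (lookup (rootLabel (proj₂ c)) i) ⇔ i ∈ proj₁ c))
                     × DirOK (proj₂ c)) cs →
          DirOK (lnode l cs)

Above : ∀ {d} → Label d → Label d → Set
Above {d} v u = ∀ (i : Fin d) (a b : ℕ) → lookup v i ≡ just a → lookup u i ≡ just b → b < a

data DescOK {d : ℕ} : LTree d → Set where
  lnode : ∀ {l cs} →
          All (λ c → All (Above l) (labels (proj₂ c)) × DescOK (proj₂ c)) cs →
          DescOK (lnode l cs)

vals : ∀ {d} → Fin d → LTree d → List ℕ
vals i L = mapMaybe (λ l → lookup l i) (labels L)

open LMem using () renaming (_∈_ to _∈ₗ_)

CoordOK : ∀ {d} → Fin d → LTree d → Set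
CoordOK i L = Unique (vals i L) ×
              ∃ λ m → ∀ (x : ℕ) → (x ∈ₗ vals i L) ⇔ (1 ≤ x × x ≤ m)

IsNAT : ∀ {d} → Tree d → LTree d → Set
IsNAT {d} M L = shape L ≡ M × RootOK L × DirOK L × DescOK L × (∀ (i : Fin d) → CoordOK i L)

prodFin : (d : ℕ) → (Fin d → ℕ) → ℕ
prodFin d f = product (map f (allFin d))

-- In each coordinate only the relative order of the values matters, so generalise from the values
-- {1,…,w_i} to arbitrary prescribed sets of values. Since labels decrease downwards, the root must take the
-- largest value of each coordinate of its direction; the remaining values of coordinate i are then shared
-- between the subtree of the first child and the other children, which can be done in a binomial number of
-- ways, independently in each coordinate. Hence |NAT(M)| = ∏_i linExt_i(M), where linExt_i(M) is the number
-- of linear extensions of the forest of vertices whose direction contains i, and this binomial recursion is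
-- also satisfied by (w_i − 1)! / ∏_U E_i(U), which is the hook length formula for forests.

module Submission where

open import Defs
open import Data.Bool using (Bool; true; false; not; if_then_else_)
open import Data.Empty using (⊥-elim)
open import Data.Fin using (Fin; zero; suc)
open import Data.Fin.Subset using (Subset; ⊤) renaming (_∈_ to _∈ₛ_)
open import Data.Fin.Subset.Properties using (∈⊤)
open import Data.List using (List; []; _∷_; length; map; _++_; mapMaybe; head; drop; allFin; applyDownFrom)
open import Data.List.Membership.Propositional using (_∈_; _∉_)
open import Data.List.Membership.Propositional.Properties
  using (∈-map⁺; ∈-map⁻; ∈-++⁺ˡ; ∈-++⁺ʳ; ∈-++⁻; ∈-applyDownFrom⁺; ∈-applyDownFrom⁻)
open import Data.List.Membership.Propositional.Properties.WithK using (unique∧set⇒bag)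
open import Data.List.Properties
  using (length-map; length-++; length-applyDownFrom; map-tabulate; map-cong; mapMaybe-++; ∷-injectiveʳ)
open import Data.List.Relation.Binary.BagAndSetEquality using (∼bag⇒↭)
open import Data.List.Relation.Binary.Disjoint.Propositional using (Disjoint)
open import Data.List.Relation.Binary.Permutation.Propositional.Properties using (↭-length)
open import Data.List.Relation.Binary.Sublist.Propositional using (_⊆_; []; _∷_; _∷ʳ_; minimum)
open import Data.List.Relation.Binary.Sublist.Propositional.Properties using (All-resp-⊆; Any-resp-⊆)
open import Data.List.Relation.Unary.All as All using (All; []; _∷_)
import Data.List.Relation.Unary.All.Properties as All
open import Data.List.Relation.Unary.AllPairs as AllPairs using (AllPairs; []; _∷_)
import Data.List.Relation.Unary.AllPairs.Properties as AllPairs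
open import Data.List.Relation.Unary.Any using (here; there)
open import Data.List.Relation.Unary.Unique.Propositional using (Unique)
import Data.List.Relation.Unary.Unique.Propositional.Properties as Unique
open import Data.Maybe using (Maybe; just; nothing; Is-just)
open import Data.Maybe.Relation.Unary.Any using () renaming (just to is-just)
open import Data.Nat using (ℕ; zero; suc; _+_; _*_; _∸_; _!; _≤_; _<_; _>_; _≟_; s≤s; s<s; z≤n)
open import Data.Nat.Combinatorics using (_C_; nCn≡1; nCk+nC[k+1]≡[n+1]C[k+1]; nCk≡n!/k![n-k]!; k![n∸k]!∣n!)
open import Data.Nat.DivMod using (m/n*n≡m)
open import Data.Nat.ListAction using (product)
open import Data.Nat.Properties
  using ( _!*_!≢0; <-irrefl; <-asym; *-assoc; *-commutativeSemigroup; +-suc; +-identityʳ; suc-injective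
        ; m+n∸m≡n; m≤m+n)
open import Algebra.Properties.CommutativeSemigroup *-commutativeSemigroup using (interchange)
open import Data.Nat.Tactic.RingSolver using (solve-∀)
open import Data.Product using (Σ; ∃; _×_; _,_; proj₁; proj₂)
import Data.Product as Product
open import Data.Product.Properties using (,-injectiveʳ)
open import Data.Sum using (_⊎_; inj₁; inj₂)
import Data.Sum as Sum
open import Data.Unit using (tt)
open import Data.Vec using (Vec; []; _∷_; lookup; tabulate)
open import Data.Vec.Properties
  using ([]=⇒lookup; lookup⇒[]=; lookup∘tabulate; tabulate∘lookup; tabulate-cong; lookup-replicate)
open import Function.Base using (_∘_; case_of_)
open import Function.Bundles using (_⇔_; mk⇔; Equivalence)
open import Function.Properties.Equivalence using () renaming (sym to ⇔-sym; trans to ⇔-trans)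
open import Relation.Binary.Definitions using (DecidableEquality)
open import Relation.Binary.PropositionalEquality
open import Relation.Nullary using (does; yes; no; ¬_)
open import Relation.Unary using (Decidable)

open Equivalence using (to; from)

private
  variable
    A B : Set
    n m : ℕ

-- Duplicate-free listings

_Lists_ : List A → List A → Set
xs Lists ys = Unique xs × (∀ {x} → x ∈ xs ⇔ x ∈ ys)

unique∧set⇒length≡ : {xs ys : List A} → Unique xs → Unique ys →
  (∀ {x} → x ∈ xs ⇔ x ∈ ys) → length xs ≡ length ys
unique∧set⇒length≡ u v e = ↭-length (∼bag⇒↭ (unique∧set⇒bag u v e))

Lists⇒length≡ : {xs ys : List A} → Unique ys → xs Lists ys → length xs ≡ length ys
Lists⇒length≡ u (v , e) = unique∧set⇒length≡ v u e

[]-Lists : ∀ {xs : List A} → length xs ≡ 0 → [] Lists xs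
[]-Lists {xs = []} _ = [] , mk⇔ (λ ()) (λ ())

Unique-++⁻ : (xs : List A) {ys : List A} → Unique (xs ++ ys) → Unique xs × Unique ys × Disjoint xs ys
Unique-++⁻ []       u          = [] , u , λ ()
Unique-++⁻ (x ∷ xs) (x∉ ∷ u) with Unique-++⁻ xs u | All.++⁻ xs x∉
... | uxs , uys , disj | x∉xs , x∉ys =
  x∉xs ∷ uxs , uys ,
  λ { (here refl , y∈) → All.lookup x∉ys y∈ refl ; (there y∈ , z∈) → disj (y∈ , z∈) }

Unique-map-injectiveOn : {P : A → Set} {xs : List A} (f : A → B) →
  (∀ {x y} → P x → P y → f x ≡ f y → x ≡ y) → All P xs → Unique xs → Unique (map f xs)
Unique-map-injectiveOn f inj []         []         = []
Unique-map-injectiveOn f inj (px ∷ pxs) (x∉ ∷ u) =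
  All.map⁺ (All.zipWith (λ (py , x≢y) fx≡fy → x≢y (inj px py fx≡fy)) (pxs , x∉))
  ∷ Unique-map-injectiveOn f inj pxs u

AllPairs-resp-⊆ : {R : A → A → Set} {xs ys : List A} → xs ⊆ ys → AllPairs R ys → AllPairs R xs
AllPairs-resp-⊆ []        []       = []
AllPairs-resp-⊆ (y ∷ʳ τ)  (_ ∷ rs) = AllPairs-resp-⊆ τ rs
AllPairs-resp-⊆ (refl ∷ τ) (r ∷ rs) = All-resp-⊆ τ r ∷ AllPairs-resp-⊆ τ rs

module _ (f : A → Maybe B) where

  ∈-mapMaybe⁺ : ∀ {xs x y} → x ∈ xs → f x ≡ just y → y ∈ mapMaybe f xs
  ∈-mapMaybe⁺ {x ∷ xs} (here refl) fx≡y rewrite fx≡y = here refl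
  ∈-mapMaybe⁺ {x ∷ xs} (there x∈) fx≡y with f x
  ... | just _  = there (∈-mapMaybe⁺ x∈ fx≡y)
  ... | nothing = ∈-mapMaybe⁺ x∈ fx≡y

  ∈-mapMaybe⁻ : ∀ xs {y} → y ∈ mapMaybe f xs → ∃ λ x → x ∈ xs × f x ≡ just y
  ∈-mapMaybe⁻ (x ∷ xs) y∈ with f x in fx≡
  ∈-mapMaybe⁻ (x ∷ xs) (here refl) | just _ = x , here refl , fx≡
  ∈-mapMaybe⁻ (x ∷ xs) (there y∈) | just _ with ∈-mapMaybe⁻ xs y∈
  ... | x′ , x′∈ , eq = x′ , there x′∈ , eq
  ∈-mapMaybe⁻ (x ∷ xs) y∈ | nothing with ∈-mapMaybe⁻ xs y∈
  ... | x′ , x′∈ , eq = x′ , there x′∈ , eq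

lookup-extensionality : {u v : Vec A n} → (∀ i → lookup u i ≡ lookup v i) → u ≡ v
lookup-extensionality {u = u} {v} eq =
  trans (sym (tabulate∘lookup u)) (trans (tabulate-cong eq) (tabulate∘lookup v))

-- Enumerations

record Enumeration {A : Set} (P : A → Set) (n : ℕ) : Set where
  constructor enumeration
  field
    elements : List A
    unique   : Unique elements
    ∈⇔       : ∀ {x} → x ∈ elements ⇔ P x
    length≡  : length elements ≡ n

open Enumeration

enumeration-map : {P : A → Set} {Q : B → Set} (f : A → B) →
  (∀ {x y} → P x → P y → f x ≡ f y → x ≡ y) →
  (∀ {x} → P x → Q (f x)) → (∀ {y} → Q y → ∃ λ x → P x × f x ≡ y) →
  Enumeration P n → Enumeration Q n
enumeration-map {P = P} {Q = Q} f inj sound complete (enumeration xs u mem len) =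
  enumeration (map f xs) (Unique-map-injectiveOn f inj allP u)
    (mk⇔ (λ y∈ → let x , x∈ , y≡fx = ∈-map⁻ f y∈ in subst Q (sym y≡fx) (sound (to mem x∈)))
         (λ qy → let x , px , fx≡y = complete qy in subst (_∈ map f xs) fx≡y (∈-map⁺ f (from mem px))))
    (trans (length-map f xs) len)
  where
  allP : All P xs
  allP = All.tabulate (to mem)

module _ {P : A → Set} {Q : A → B → Set} (enumQ : ∀ {x} → P x → Enumeration (Q x) m) where

  private
    pairs : (xs : List A) → All P xs → List (A × B)
    pairs []       []         = []
    pairs (x ∷ xs) (px ∷ pxs) = map (x ,_) (elements (enumQ px)) ++ pairs xs pxs

    ∈-pairs : ∀ xs pxs {x y} → (x , y) ∈ pairs xs pxs ⇔ (x ∈ xs × Q x y)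
    ∈-pairs []       []         = mk⇔ (λ ()) (λ ())
    ∈-pairs (x ∷ xs) (px ∷ pxs) = mk⇔ forth back
      where
      forth : ∀ {z y} → (z , y) ∈ pairs (x ∷ xs) (px ∷ pxs) → z ∈ x ∷ xs × Q z y
      forth zy∈ with ∈-++⁻ (map (x ,_) _) zy∈
      ... | inj₁ zy∈₁ with ∈-map⁻ (x ,_) zy∈₁
      ...   | _ , y∈ , refl = here refl , to (∈⇔ (enumQ px)) y∈
      forth zy∈ | inj₂ zy∈₂ = let z∈ , q = to (∈-pairs xs pxs) zy∈₂ in there z∈ , q
      back : ∀ {z y} → z ∈ x ∷ xs × Q z y → (z , y) ∈ pairs (x ∷ xs) (px ∷ pxs)
      back (here refl , q) = ∈-++⁺ˡ (∈-map⁺ (x ,_) (from (∈⇔ (enumQ px)) q))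
      back (there z∈ , q)  = ∈-++⁺ʳ _ (from (∈-pairs xs pxs) (z∈ , q))

    unique-pairs : ∀ xs pxs → Unique xs → Unique (pairs xs pxs)
    unique-pairs []       []         []       = []
    unique-pairs (x ∷ xs) (px ∷ pxs) (x∉ ∷ u) =
      Unique.++⁺ (Unique.map⁺ ,-injectiveʳ (unique (enumQ px))) (unique-pairs xs pxs u) disjoint
      where
      disjoint : Disjoint (map (x ,_) _) (pairs xs pxs)
      disjoint (p∈₁ , p∈₂) with ∈-map⁻ (x ,_) p∈₁
      ... | _ , _ , refl = All.lookup x∉ (proj₁ (to (∈-pairs xs pxs) p∈₂)) refl

    length-pairs : ∀ xs pxs → length (pairs xs pxs) ≡ length xs * m
    length-pairs []       []         = refl
    length-pairs (x ∷ xs) (px ∷ pxs) = begin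
      length (map (x ,_) ys ++ pairs xs pxs)          ≡⟨ length-++ (map (x ,_) ys) ⟩
      length (map (x ,_) ys) + length (pairs xs pxs)  ≡⟨ cong₂ _+_ (trans (length-map _ ys) (length≡ (enumQ px)))
                                                                   (length-pairs xs pxs) ⟩
      m + length xs * m                               ∎
      where
      open ≡-Reasoning
      ys : List B
      ys = elements (enumQ px)

  enumeration-Σ : Enumeration P n → Enumeration (λ (p : A × B) → P (proj₁ p) × Q (proj₁ p) (proj₂ p)) (n * m)
  enumeration-Σ (enumeration xs u mem len) =
    enumeration (pairs xs allP) (unique-pairs xs allP u)
      (mk⇔ (λ p∈ → let x∈ , q = to (∈-pairs xs allP) p∈ in to mem x∈ , q)
           (λ (px , q) → from (∈-pairs xs allP) (from mem px , q)))
      (trans (length-pairs xs allP) (cong (_* m) len))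
    where
    allP : All P xs
    allP = All.tabulate (to mem)

prodFin-suc : ∀ d (f : Fin (suc d) → ℕ) → prodFin (suc d) f ≡ f zero * prodFin d (λ i → f (suc i))
prodFin-suc d f = cong (λ xs → f zero * product xs)
  (trans (map-tabulate suc f) (sym (map-tabulate (λ i → i) (λ i → f (suc i)))))

prodFin-cong : ∀ d {f g : Fin d → ℕ} → (∀ i → f i ≡ g i) → prodFin d f ≡ prodFin d g
prodFin-cong d f≗g = cong product (map-cong f≗g (allFin d))

product-map-* : (f g : A → ℕ) (xs : List A) →
  product (map (λ x → f x * g x) xs) ≡ product (map f xs) * product (map g xs)
product-map-* f g []       = refl
product-map-* f g (x ∷ xs) = trans (cong (f x * g x *_) (product-map-* f g xs))
  (interchange (f x) (g x) (product (map f xs)) (product (map g xs)))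

prodFin-* : ∀ d (f g : Fin d → ℕ) → prodFin d (λ i → f i * g i) ≡ prodFin d f * prodFin d g
prodFin-* d f g = product-map-* f g (allFin d)

product-map-1 : (xs : List A) → product (map (λ _ → 1) xs) ≡ 1
product-map-1 []       = refl
product-map-1 (x ∷ xs) = trans (+-identityʳ _) (product-map-1 xs)

enumeration-Vec : ∀ d {P : Fin d → A → Set} {n : Fin d → ℕ} → (∀ i → Enumeration (P i) (n i)) →
  Enumeration (λ (v : Vec A d) → ∀ i → P i (lookup v i)) (prodFin d n)
enumeration-Vec zero    E = enumeration ([] ∷ []) ([] ∷ []) (λ { {[]} → mk⇔ (λ _ ()) (λ _ → here refl) }) refl
enumeration-Vec (suc d) {n = n} E =
  subst (Enumeration _) (sym (prodFin-suc d n))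
    (enumeration-map (λ (x , v) → x ∷ v) (λ { _ _ refl → refl })
      (λ { (px , pv) → λ { zero → px ; (suc i) → pv i } })
      (λ { {x ∷ v} pxv → (x , v) , (pxv zero , λ i → pxv (suc i)) , refl })
      (enumeration-Σ (λ _ → enumeration-Vec d (λ i → E (suc i))) (E zero)))

-- Masks

trues falses : List Bool → ℕ
trues []           = 0
trues (true ∷ bs)  = suc (trues bs)
trues (false ∷ bs) = trues bs
falses []           = 0
falses (true ∷ bs)  = falses bs
falses (false ∷ bs) = suc (falses bs)

length≡trues+falses : ∀ bs → length bs ≡ trues bs + falses bs
length≡trues+falses []           = refl
length≡trues+falses (true ∷ bs)  = cong suc (length≡trues+falses bs)
length≡trues+falses (false ∷ bs) = trans (cong suc (length≡trues+falses bs)) (sym (+-suc (trues bs) (falses bs)))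

masks : ℕ → ℕ → List (List Bool)
masks zero    zero    = [] ∷ []
masks (suc a) zero    = map (true ∷_) (masks a zero)
masks zero    (suc b) = map (false ∷_) (masks zero b)
masks (suc a) (suc b) = map (true ∷_) (masks a (suc b)) ++ map (false ∷_) (masks (suc a) b)

true∷-∈-masks : ∀ {a b bs} → bs ∈ masks a b → true ∷ bs ∈ masks (suc a) b
true∷-∈-masks {b = zero}  = ∈-map⁺ (true ∷_)
true∷-∈-masks {b = suc b} = λ bs∈ → ∈-++⁺ˡ (∈-map⁺ (true ∷_) bs∈)

false∷-∈-masks : ∀ {a b bs} → bs ∈ masks a b → false ∷ bs ∈ masks a (suc b)
false∷-∈-masks {a = zero}  = ∈-map⁺ (false ∷_)
false∷-∈-masks {a = suc a} = λ bs∈ → ∈-++⁺ʳ _ (∈-map⁺ (false ∷_) bs∈)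

∈-masks⁺ : ∀ bs → bs ∈ masks (trues bs) (falses bs)
∈-masks⁺ []           = here refl
∈-masks⁺ (true ∷ bs)  = true∷-∈-masks {trues bs} {falses bs} (∈-masks⁺ bs)
∈-masks⁺ (false ∷ bs) = false∷-∈-masks {trues bs} {falses bs} (∈-masks⁺ bs)

∈-masks⁻ : ∀ a b {bs} → bs ∈ masks a b → trues bs ≡ a × falses bs ≡ b
∈-masks⁻ zero    zero    (here refl) = refl , refl
∈-masks⁻ (suc a) zero    bs∈ with ∈-map⁻ (true ∷_) bs∈
... | _ , bs∈′ , refl = let t , f = ∈-masks⁻ a zero bs∈′ in cong suc t , f
∈-masks⁻ zero    (suc b) bs∈ with ∈-map⁻ (false ∷_) bs∈
... | _ , bs∈′ , refl = let t , f = ∈-masks⁻ zero b bs∈′ in t , cong suc f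
∈-masks⁻ (suc a) (suc b) bs∈ with ∈-++⁻ (map (true ∷_) (masks a (suc b))) bs∈
... | inj₁ bs∈₁ with ∈-map⁻ (true ∷_) bs∈₁
...   | _ , bs∈′ , refl = let t , f = ∈-masks⁻ a (suc b) bs∈′ in cong suc t , f
∈-masks⁻ (suc a) (suc b) bs∈ | inj₂ bs∈₂ with ∈-map⁻ (false ∷_) bs∈₂
...   | _ , bs∈′ , refl = let t , f = ∈-masks⁻ (suc a) b bs∈′ in t , cong suc f

unique-masks : ∀ a b → Unique (masks a b)
unique-masks zero    zero    = [] ∷ []
unique-masks (suc a) zero    = Unique.map⁺ ∷-injectiveʳ (unique-masks a zero)
unique-masks zero    (suc b) = Unique.map⁺ ∷-injectiveʳ (unique-masks zero b)
unique-masks (suc a) (suc b) =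
  Unique.++⁺ (Unique.map⁺ ∷-injectiveʳ (unique-masks a (suc b)))
             (Unique.map⁺ ∷-injectiveʳ (unique-masks (suc a) b))
             disjoint
  where
  disjoint : Disjoint (map (true ∷_) (masks a (suc b))) (map (false ∷_) (masks (suc a) b))
  disjoint (bs∈₁ , bs∈₂) with ∈-map⁻ (true ∷_) bs∈₁ | ∈-map⁻ (false ∷_) bs∈₂
  ... | _ , _ , refl | _ , _ , ()

length-masks : ∀ a b → length (masks a b) ≡ (a + b) C a
length-masks zero    zero    = refl
length-masks (suc a) zero    = begin
  length (map (true ∷_) (masks a zero)) ≡⟨ length-map _ (masks a zero) ⟩
  length (masks a zero)                 ≡⟨ length-masks a zero ⟩
  (a + 0) C a                           ≡⟨ cong (_C a) (+-identityʳ a) ⟩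
  a C a                                 ≡⟨ trans (nCn≡1 a) (sym (nCn≡1 (suc a))) ⟩
  suc a C suc a                         ≡⟨ cong (_C suc a) (sym (+-identityʳ (suc a))) ⟩
  (suc a + 0) C suc a                   ∎
  where open ≡-Reasoning
length-masks zero    (suc b) = trans (length-map _ (masks zero b)) (length-masks zero b)
length-masks (suc a) (suc b) = begin
  length (map (true ∷_) (masks a (suc b)) ++ map (false ∷_) (masks (suc a) b))
    ≡⟨ length-++ (map (true ∷_) (masks a (suc b))) ⟩
  length (map (true ∷_) (masks a (suc b))) + length (map (false ∷_) (masks (suc a) b))
    ≡⟨ cong₂ _+_ (length-map _ (masks a (suc b))) (length-map _ (masks (suc a) b)) ⟩
  length (masks a (suc b)) + length (masks (suc a) b)
    ≡⟨ cong₂ _+_ (length-masks a (suc b)) (length-masks (suc a) b) ⟩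
  (a + suc b) C a + suc (a + b) C suc a
    ≡⟨ cong (λ n → (a + suc b) C a + n C suc a) (sym (+-suc a b)) ⟩
  (a + suc b) C a + (a + suc b) C suc a
    ≡⟨ nCk+nC[k+1]≡[n+1]C[k+1] (a + suc b) a ⟩
  (suc a + suc b) C suc a ∎
  where open ≡-Reasoning

enumeration-masks : ∀ a b → Enumeration (λ bs → trues bs ≡ a × falses bs ≡ b) ((a + b) C a)
enumeration-masks a b = enumeration (masks a b) (unique-masks a b)
  (λ {bs} → mk⇔ (∈-masks⁻ a b) (λ { (refl , refl) → ∈-masks⁺ bs })) (length-masks a b)

nCk*k!*[n∸k]!≡n! : ∀ {n k} → k ≤ n → (n C k) * (k ! * (n ∸ k) !) ≡ n !
nCk*k!*[n∸k]!≡n! {n} {k} k≤n =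
  trans (cong (_* (k ! * (n ∸ k) !)) (nCk≡n!/k![n-k]! k≤n)) (m/n*n≡m (k![n∸k]!∣n! k≤n))
  where instance _ = k !* (n ∸ k) !≢0

[m+n]Cm*m!*n!≡[m+n]! : ∀ m n → ((m + n) C m) * (m ! * n !) ≡ (m + n) !
[m+n]Cm*m!*n!≡[m+n]! m n =
  subst (λ k → ((m + n) C m) * (m ! * k !) ≡ (m + n) !) (m+n∸m≡n m n) (nCk*k!*[n∸k]!≡n! (m≤m+n m n))

-- Selecting along a mask

select : List Bool → List A → List A
select []           _        = []
select (_ ∷ _)      []       = []
select (true ∷ bs)  (x ∷ xs) = x ∷ select bs xs
select (false ∷ bs) (x ∷ xs) = select bs xs

select-⊆ : ∀ bs (xs : List A) → select bs xs ⊆ xs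
select-⊆ []           xs       = minimum xs
select-⊆ (_ ∷ _)      []       = []
select-⊆ (true ∷ bs)  (x ∷ xs) = refl ∷ select-⊆ bs xs
select-⊆ (false ∷ bs) (x ∷ xs) = x ∷ʳ select-⊆ bs xs

∈-select⁻ : ∀ bs {xs : List A} {x} → x ∈ select bs xs → x ∈ xs
∈-select⁻ bs {xs} = Any-resp-⊆ (select-⊆ bs xs)

Unique-select : ∀ bs {xs : List A} → Unique xs → Unique (select bs xs)
Unique-select bs {xs} = AllPairs-resp-⊆ (select-⊆ bs xs)

length-select : ∀ bs (xs : List A) → length bs ≡ length xs → length (select bs xs) ≡ trues bs
length-select []           []       _  = refl
length-select (true ∷ bs)  (x ∷ xs) eq = cong suc (length-select bs xs (suc-injective eq))
length-select (false ∷ bs) (x ∷ xs) eq = length-select bs xs (suc-injective eq)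

length-select-not : ∀ bs (xs : List A) → length bs ≡ length xs → length (select (map not bs) xs) ≡ falses bs
length-select-not []           []       _  = refl
length-select-not (true ∷ bs)  (x ∷ xs) eq = length-select-not bs xs (suc-injective eq)
length-select-not (false ∷ bs) (x ∷ xs) eq = cong suc (length-select-not bs xs (suc-injective eq))

Lists-select⇒trues : ∀ bs {xs ys : List A} → Unique xs → length bs ≡ length xs →
  ys Lists select bs xs → trues bs ≡ length ys
Lists-select⇒trues bs {xs} u len ys≈ =
  trans (sym (length-select bs xs len)) (sym (Lists⇒length≡ (Unique-select bs u) ys≈))

Lists-select⇒falses : ∀ bs {xs ys : List A} → Unique xs → length bs ≡ length xs →
  ys Lists select (map not bs) xs → falses bs ≡ length ys
Lists-select⇒falses bs {xs} u len ys≈ =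
  trans (sym (length-select-not bs xs len)) (sym (Lists⇒length≡ (Unique-select (map not bs) u) ys≈))

select-complement : ∀ bs (xs : List A) {x} → length bs ≡ length xs → x ∈ xs →
  x ∈ select bs xs ⊎ x ∈ select (map not bs) xs
select-complement (true ∷ bs)  (y ∷ xs) _  (here refl) = inj₁ (here refl)
select-complement (false ∷ bs) (y ∷ xs) _  (here refl) = inj₂ (here refl)
select-complement (true ∷ bs)  (y ∷ xs) eq (there x∈) =
  Sum.map₁ there (select-complement bs xs (suc-injective eq) x∈)
select-complement (false ∷ bs) (y ∷ xs) eq (there x∈) =
  Sum.map₂ there (select-complement bs xs (suc-injective eq) x∈)

select-disjoint : ∀ bs {xs : List A} → Unique xs → Disjoint (select bs xs) (select (map not bs) xs)
select-disjoint []           {[]}     _        ()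
select-disjoint (_ ∷ _)      {[]}     _        ()
select-disjoint (true ∷ bs)  {x ∷ xs} (x∉ ∷ u) (here refl , x∈) =
  All.lookup x∉ (∈-select⁻ (map not bs) x∈) refl
select-disjoint (true ∷ bs)  {x ∷ xs} (x∉ ∷ u) (there y∈ , y∈′) = select-disjoint bs u (y∈ , y∈′)
select-disjoint (false ∷ bs) {x ∷ xs} (x∉ ∷ u) (x∈ , here refl) =
  All.lookup x∉ (∈-select⁻ bs x∈) refl
select-disjoint (false ∷ bs) {x ∷ xs} (x∉ ∷ u) (y∈ , there y∈′) = select-disjoint bs u (y∈ , y∈′)

select-injective : ∀ bs cs {xs : List A} → Unique xs → length bs ≡ length xs → length cs ≡ length xs →
  (∀ {x} → x ∈ select bs xs ⇔ x ∈ select cs xs) → bs ≡ cs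
select-injective []       []       {[]}     _        _   _   _ = refl
select-injective (b ∷ bs) (c ∷ cs) {x ∷ xs} (x∉ ∷ u) eqb eqc same with b | c
... | true  | true  = cong (true ∷_) (select-injective bs cs u (suc-injective eqb) (suc-injective eqc)
                        (mk⇔ (strip bs cs (to same)) (strip cs bs (from same))))
  where
  strip : ∀ bs cs {y} → (∀ {y} → y ∈ x ∷ select bs xs → y ∈ x ∷ select cs xs) →
    y ∈ select bs xs → y ∈ select cs xs
  strip bs cs sub y∈ with sub (there y∈)
  ... | here refl = ⊥-elim (All.lookup x∉ (∈-select⁻ bs y∈) refl)
  ... | there y∈′ = y∈′
... | false | false = cong (false ∷_) (select-injective bs cs u (suc-injective eqb) (suc-injective eqc) same)
... | true  | false = ⊥-elim (All.lookup x∉ (∈-select⁻ cs (to same (here refl))) refl)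
... | false | true  = ⊥-elim (All.lookup x∉ (∈-select⁻ bs (from same (here refl))) refl)

module _ {P : A → Set} (P? : Decidable P) where

  ∈-select-does : ∀ xs {x} → x ∈ select (map (does ∘ P?) xs) xs ⇔ (x ∈ xs × P x)
  ∈-select-does []       = mk⇔ (λ ()) (λ ())
  ∈-select-does (y ∷ ys) with P? y
  ... | yes py = mk⇔
    (λ { (here refl) → here refl , py ; (there x∈) → Product.map₁ there (to (∈-select-does ys) x∈) })
    (λ { (here refl , _) → here refl ; (there x∈ , px) → there (from (∈-select-does ys) (x∈ , px)) })
  ... | no ¬py = mk⇔
    (λ x∈ → Product.map₁ there (to (∈-select-does ys) x∈))
    (λ { (here refl , py) → ⊥-elim (¬py py) ; (there x∈ , px) → from (∈-select-does ys) (x∈ , px) })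

  ∈-select-not-does : ∀ xs {x} → x ∈ select (map not (map (does ∘ P?) xs)) xs ⇔ (x ∈ xs × ¬ P x)
  ∈-select-not-does []       = mk⇔ (λ ()) (λ ())
  ∈-select-not-does (y ∷ ys) with P? y
  ... | yes py = mk⇔
    (λ x∈ → Product.map₁ there (to (∈-select-not-does ys) x∈))
    (λ { (here refl , ¬py) → ⊥-elim (¬py py) ; (there x∈ , ¬px) → from (∈-select-not-does ys) (x∈ , ¬px) })
  ... | no ¬py = mk⇔
    (λ { (here refl) → here refl , ¬py ; (there x∈) → Product.map₁ there (to (∈-select-not-does ys) x∈) })
    (λ { (here refl , _) → here refl ; (there x∈ , ¬px) → there (from (∈-select-not-does ys) (x∈ , ¬px)) })

Lists-++ : ∀ bs {xs ys zs : List A} → Unique xs → length bs ≡ length xs →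
  ys Lists select bs xs → zs Lists select (map not bs) xs → (ys ++ zs) Lists xs
Lists-++ bs {xs} {ys} u len (uys , ys≈) (uzs , zs≈) =
  Unique.++⁺ uys uzs (λ (x∈ys , x∈zs) → select-disjoint bs u (to ys≈ x∈ys , to zs≈ x∈zs)) ,
  mk⇔ forth back
  where
  forth : ∀ {x} → x ∈ ys ++ _ → x ∈ xs
  forth x∈ with ∈-++⁻ ys x∈
  ... | inj₁ x∈ys = ∈-select⁻ bs (to ys≈ x∈ys)
  ... | inj₂ x∈zs = ∈-select⁻ (map not bs) (to zs≈ x∈zs)
  back : ∀ {x} → x ∈ xs → x ∈ ys ++ _
  back x∈ with select-complement bs xs len x∈
  ... | inj₁ x∈₁ = ∈-++⁺ˡ (from ys≈ x∈₁)
  ... | inj₂ x∈₂ = ∈-++⁺ʳ ys (from zs≈ x∈₂)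

module _ (_≟_ : DecidableEquality A) where

  open import Data.List.Membership.DecPropositional _≟_ using (_∈?_)

  maskOf : List A → List A → List Bool
  maskOf ys xs = map (λ x → does (x ∈? ys)) xs

  Lists-++⁻ : ∀ {xs} ys {zs} → (ys ++ zs) Lists xs →
    ys Lists select (maskOf ys xs) xs × zs Lists select (map not (maskOf ys xs)) xs
  Lists-++⁻ {xs} ys {zs} (u , ≈xs) with Unique-++⁻ ys u
  ... | uys , uzs , disj =
    (uys , mk⇔ (λ x∈ → from (∈-select-does (_∈? ys) xs) (to ≈xs (∈-++⁺ˡ x∈) , x∈))
               (λ x∈ → proj₂ (to (∈-select-does (_∈? ys) xs) x∈))) ,
    (uzs , mk⇔ (λ x∈ → from (∈-select-not-does (_∈? ys) xs) (to ≈xs (∈-++⁺ʳ ys x∈) , λ x∈ys → disj (x∈ys , x∈)))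
               (λ x∈ → let x∈xs , x∉ys = to (∈-select-not-does (_∈? ys) xs) x∈ in zs-of (from ≈xs x∈xs) x∉ys))
    where
    zs-of : ∀ {x} → x ∈ ys ++ zs → x ∉ ys → x ∈ zs
    zs-of x∈ x∉ys with ∈-++⁻ ys x∈
    ... | inj₁ x∈ys = ⊥-elim (x∉ys x∈ys)
    ... | inj₂ x∈zs = x∈zs

-- Strictly decreasing lists

Decreasing : List ℕ → Set
Decreasing = AllPairs _>_

Decreasing⇒Unique : ∀ {xs} → Decreasing xs → Unique xs
Decreasing⇒Unique = AllPairs.map (λ x>y x≡y → <-irrefl (sym x≡y) x>y)

∷-Lists-∷ : ∀ {h t ys} → Decreasing (h ∷ t) → ys Lists t → (h ∷ ys) Lists (h ∷ t)
∷-Lists-∷ (h>t ∷ _) (u , ys≈t) =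
  All.tabulate (λ y∈ h≡y → <-irrefl (sym h≡y) (All.lookup h>t (to ys≈t y∈))) ∷ u ,
  mk⇔ (λ { (here refl) → here refl ; (there y∈) → there (to ys≈t y∈) })
      (λ { (here refl) → here refl ; (there y∈) → there (from ys≈t y∈) })

∷-Lists-∷⁻ : ∀ {h h′ t ys} → Decreasing (h ∷ t) → All (_< h′) ys → (h′ ∷ ys) Lists (h ∷ t) →
  h′ ≡ h × ys Lists t
∷-Lists-∷⁻ {h} {h′} {t} {ys} (h>t ∷ _) ys<h′ (h′∉ ∷ u , ≈) = h′≡h , u , mk⇔ forth back
  where
  h′≡h : h′ ≡ h
  h′≡h with to ≈ (here refl) | from ≈ (here refl)
  ... | here h′≡h | _          = h′≡h
  ... | there _   | here h≡h′  = sym h≡h′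
  ... | there h′∈ | there h∈   = ⊥-elim (<-asym (All.lookup h>t h′∈) (All.lookup ys<h′ h∈))
  forth : ∀ {x} → x ∈ ys → x ∈ t
  forth x∈ with to ≈ (there x∈)
  ... | here x≡h  = ⊥-elim (All.lookup h′∉ x∈ (trans h′≡h (sym x≡h)))
  ... | there x∈t = x∈t
  back : ∀ {x} → x ∈ t → x ∈ ys
  back x∈ with from ≈ (there x∈)
  ... | here x≡h′ = ⊥-elim (<-irrefl (trans x≡h′ h′≡h) (All.lookup h>t x∈))
  ... | there x∈ys = x∈ys

interval : ℕ → List ℕ
interval n = applyDownFrom suc n

∈-interval : ∀ {n x} → x ∈ interval n ⇔ (1 ≤ x × x ≤ n)
∈-interval = mk⇔
  (λ x∈ → let _ , i<n , x≡1+i = ∈-applyDownFrom⁻ suc x∈ in subst (λ x → 1 ≤ x × x ≤ _) (sym x≡1+i) (s≤s z≤n , i<n))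
  (λ { (s≤s z≤n , x≤n) → ∈-applyDownFrom⁺ suc x≤n })

Decreasing-interval : ∀ n → Decreasing (interval n)
Decreasing-interval n = AllPairs.applyDownFrom⁺₁ suc n (λ j<i _ → s<s j<i)

-- Labellings with prescribed values

module _ {d : ℕ} where

  forestVals : Fin d → List (Subset d × LTree d) → List ℕ
  forestVals i r = mapMaybe (λ l → lookup l i) (labelsL r)

  forestVals-∷ : ∀ i π (L : LTree d) r → forestVals i ((π , L) ∷ r) ≡ vals i L ++ forestVals i r
  forestVals-∷ i π L r = mapMaybe-++ (λ l → lookup l i) (labels L) (labelsL r)

  vals-just : ∀ {i h} l r → lookup l i ≡ just h → vals i (lnode l r) ≡ h ∷ forestVals i r
  vals-just l r li≡h rewrite li≡h = refl

  vals-nothing : ∀ {i} l r → lookup l i ≡ nothing → vals i (lnode l r) ≡ forestVals i r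
  vals-nothing l r li≡• rewrite li≡• = refl

  indic-marked : ∀ {i : Fin d} π → lookup π i ≡ true → indic i π ≡ 1
  indic-marked π πi = cong (λ b → if b then 1 else 0) πi

  indic-unmarked : ∀ {i : Fin d} π → lookup π i ≡ false → indic i π ≡ 0
  indic-unmarked π πi = cong (λ b → if b then 1 else 0) πi

  HasDirection : Subset d → Label d → Set
  HasDirection π l = ∀ i → Is-just (lookup l i) ⇔ i ∈ₛ π

  RootDirection : Subset d → LTree d → Set
  RootDirection π L = HasDirection π (rootLabel L)

  WellDirected : Subset d × LTree d → Set
  WellDirected c = RootDirection (proj₁ c) (proj₂ c) × DirOK (proj₂ c)

  data RootView (π : Subset d) (l : Label d) (i : Fin d) : Set where
    marked   : ∀ {h} → lookup π i ≡ true → lookup l i ≡ just h → RootView π l i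
    unmarked : lookup π i ≡ false → lookup l i ≡ nothing → RootView π l i

  rootView : ∀ {π} (l : Label d) → HasDirection π l → ∀ i → RootView π l i
  rootView {π} l dir i with lookup π i in πi | lookup l i in li
  ... | true  | just _  = marked πi li
  ... | false | nothing = unmarked πi li
  ... | true  | nothing with () ← subst Is-just li (from (dir i) (lookup⇒[]= i π πi))
  ... | false | just _  with () ← trans (sym ([]=⇒lookup (to (dir i) (subst Is-just (sym li) (is-just tt))))) πi

  mutual
    length-vals : ∀ i π L → WellDirected (π , L) → length (vals i L) ≡ indic i π + cnt i (shape L)
    length-vals i π (lnode l r) (dir , lnode wds) with rootView l dir i
    ... | marked   πi li = trans (cong length (vals-just l r li))
                               (cong₂ _+_ (sym (indic-marked π πi)) (length-forestVals i r wds))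
    ... | unmarked πi li = trans (cong length (vals-nothing l r li))
                               (cong₂ _+_ (sym (indic-unmarked π πi)) (length-forestVals i r wds))

    length-forestVals : ∀ i r → All WellDirected r → length (forestVals i r) ≡ cntL i (shapeL r)
    length-forestVals i []            []         = refl
    length-forestVals i ((π , L) ∷ r) (wd ∷ wds) = begin
      length (forestVals i ((π , L) ∷ r))            ≡⟨ cong length (forestVals-∷ i π L r) ⟩
      length (vals i L ++ forestVals i r)            ≡⟨ length-++ (vals i L) ⟩
      length (vals i L) + length (forestVals i r)    ≡⟨ cong₂ _+_ (length-vals i π L wd)
                                                                  (length-forestVals i r wds) ⟩
      indic i π + cnt i (shape L) + cntL i (shapeL r) ∎
      where open ≡-Reasoning

  Above⇔below : ∀ l r →
    All (Above l) (labelsL r) ⇔ (∀ i {a} → lookup l i ≡ just a → All (_< a) (forestVals i r))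
  Above⇔below l r = mk⇔
    (λ above i {a} li → All.tabulate λ b∈ →
       let u , u∈ , ui = ∈-mapMaybe⁻ (λ l → lookup l i) (labelsL r) b∈ in All.lookup above u∈ i a _ li ui)
    (λ below → All.tabulate λ u∈ i a b li ui →
       All.lookup (below i li) (∈-mapMaybe⁺ (λ l → lookup l i) u∈ ui))

  descOK-node : ∀ (l : Label d) r →
    All (Above l) (labelsL r) → All (λ c → DescOK (proj₂ c)) r → DescOK (lnode l r)
  descOK-node l r above descs = lnode (go r above descs)
    where
    go : ∀ r → All (Above l) (labelsL r) → All (λ c → DescOK (proj₂ c)) r →
      All (λ c → All (Above l) (labels (proj₂ c)) × DescOK (proj₂ c)) r
    go []            _     []             = []
    go ((π , L) ∷ r) above (desc ∷ descs) = let aL , ar = All.++⁻ (labels L) above in (aL , desc) ∷ go r ar descs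

  descOK-node⁻ : ∀ (l : Label d) r →
    DescOK (lnode l r) → All (Above l) (labelsL r) × All (λ c → DescOK (proj₂ c)) r
  descOK-node⁻ l []            (lnode [])                  = [] , []
  descOK-node⁻ l ((π , L) ∷ r) (lnode ((aL , desc) ∷ rest)) =
    let ar , descs = descOK-node⁻ l r (lnode rest) in All.++⁺ aL ar , desc ∷ descs

  -- Conditions (1) and (2) for a vertex of direction π whose subtree has shape t, with (3) replaced by:
  -- the i-th values are exactly those of A i.
  record IsLabelling (π : Subset d) (A : Fin d → List ℕ) (t : Tree d) (L : LTree d) : Set where
    field
      shape≡   : shape L ≡ t
      rootDir  : RootDirection π L
      dirOK    : DirOK L
      descOK   : DescOK L
      values   : ∀ i → vals i L Lists A i

  record IsForestLabelling (S : Fin d → List ℕ) (cs : List (Subset d × Tree d))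
                           (r : List (Subset d × LTree d)) : Set where
    field
      shapes≡  : shapeL r ≡ cs
      directed : All WellDirected r
      descOKs  : All (λ c → DescOK (proj₂ c)) r
      values   : ∀ i → forestVals i r Lists S i

  -- Labels decrease downwards, so the root takes the largest prescribed value of each coordinate of π.
  headLabel : Subset d → (Fin d → List ℕ) → Label d
  headLabel π A = tabulate (λ i → if lookup π i then head (A i) else nothing)

  dropHeads : Subset d → (Fin d → List ℕ) → Fin d → List ℕ
  dropHeads π A i = if lookup π i then drop 1 (A i) else A i

  data HeadView (π : Subset d) (A : Fin d → List ℕ) (i : Fin d) : Set where
    marked   : ∀ {h t} → lookup π i ≡ true → A i ≡ h ∷ t →
               lookup (headLabel π A) i ≡ just h → dropHeads π A i ≡ t → HeadView π A i
    unmarked : lookup π i ≡ false →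
               lookup (headLabel π A) i ≡ nothing → dropHeads π A i ≡ A i → HeadView π A i

  headView : ∀ π A i {n} → length (A i) ≡ indic i π + n → HeadView π A i
  headView π A i len with lookup π i in πi | lookup∘tabulate (λ i → if lookup π i then head (A i) else nothing) i
  ... | false | hl = unmarked πi hl (cong (λ b → if b then drop 1 (A i) else A i) πi)
  ... | true  | hl with A i in Ai
  ...   | h ∷ t = marked πi Ai hl (cong₂ (λ b xs → if b then drop 1 xs else xs) πi Ai)

  Decreasing-dropHeads : ∀ π A i {n} → Decreasing (A i) → length (A i) ≡ indic i π + n → Decreasing (dropHeads π A i)
  Decreasing-dropHeads π A i dec len with headView π A i len
  ... | marked _ Ai _ ti = subst Decreasing (sym ti) (AllPairs.tail (subst Decreasing Ai dec))
  ... | unmarked _ _ ti  = subst Decreasing (sym ti) dec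

  length-dropHeads : ∀ π A i {n} → length (A i) ≡ indic i π + n → length (dropHeads π A i) ≡ n
  length-dropHeads π A i {n} len with headView π A i len
  ... | marked πi Ai _ ti = trans (cong length ti)
                              (suc-injective (trans (cong length (sym Ai)) (trans len (cong (_+ n) (indic-marked π πi)))))
  ... | unmarked πi _ ti  = trans (cong length ti) (trans len (cong (_+ n) (indic-unmarked π πi)))

  labelling-node : ∀ π tcs A r → (∀ i → Decreasing (A i)) → (∀ i → length (A i) ≡ indic i π + cntL i tcs) →
    IsForestLabelling (dropHeads π A) tcs r → IsLabelling π A (node tcs) (lnode (headLabel π A) r)
  labelling-node π tcs A r dec len F = record
    { shape≡  = cong node shapes≡
    ; rootDir = direction
    ; dirOK   = lnode directed
    ; descOK  = descOK-node l r (from (Above⇔below l r) below) descOKs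
    ; values  = values′
    }
    where
    open IsForestLabelling F
    l : Label d
    l = headLabel π A
    direction : HasDirection π l
    direction i with headView π A i (len i)
    ... | marked πi _ li _ = mk⇔ (λ _ → lookup⇒[]= i π πi) (λ _ → subst Is-just (sym li) (is-just tt))
    ... | unmarked πi li _ = mk⇔ (λ j → case subst Is-just li j of λ ())
                                 (λ i∈π → case trans (sym ([]=⇒lookup i∈π)) πi of λ ())
    below : ∀ i {a} → lookup l i ≡ just a → All (_< a) (forestVals i r)
    below i la with headView π A i (len i)
    ... | marked _ Ai li ti with refl ← trans (sym li) la =
      All.tabulate λ b∈ →
        All.lookup (AllPairs.head (subst Decreasing Ai (dec i))) (subst (_ ∈_) ti (to (proj₂ (values i)) b∈))
    ... | unmarked _ li _ with () ← trans (sym li) la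
    values′ : ∀ i → vals i (lnode l r) Lists A i
    values′ i with headView π A i (len i)
    ... | marked _ Ai li ti = subst₂ _Lists_ (sym (vals-just l r li)) (sym Ai)
                                (∷-Lists-∷ (subst Decreasing Ai (dec i)) (subst (forestVals i r Lists_) ti (values i)))
    ... | unmarked _ li ti = subst₂ _Lists_ (sym (vals-nothing l r li)) ti (values i)

  node-injective : ∀ {cs cs′ : List (Subset d × Tree d)} → node cs ≡ node cs′ → cs ≡ cs′
  node-injective refl = refl

  DirOK-children : ∀ {l r} → DirOK (lnode l r) → All WellDirected r
  DirOK-children (lnode wds) = wds

  labelling-node⁻ : ∀ π tcs A L → (∀ i → Decreasing (A i)) → (∀ i → length (A i) ≡ indic i π + cntL i tcs) →
    IsLabelling π A (node tcs) L → ∃ λ r → IsForestLabelling (dropHeads π A) tcs r × lnode (headLabel π A) r ≡ L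
  labelling-node⁻ π tcs A (lnode l r) dec len Lab =
    r ,
    record { shapes≡ = node-injective shape≡ ; directed = DirOK-children dirOK
           ; descOKs = proj₂ (descOK-node⁻ l r descOK) ; values = λ i → proj₂ (split i) } ,
    cong (λ l → lnode l r) (lookup-extensionality (λ i → proj₁ (split i)))
    where
    open IsLabelling Lab
    below : ∀ i {a} → lookup l i ≡ just a → All (_< a) (forestVals i r)
    below = to (Above⇔below l r) (proj₁ (descOK-node⁻ l r descOK))
    split : ∀ i → lookup (headLabel π A) i ≡ lookup l i × forestVals i r Lists dropHeads π A i
    split i with headView π A i (len i) | rootView l rootDir i
    ... | marked _ Ai hi ti | marked _ li =
      let h′≡h , rest = ∷-Lists-∷⁻ (subst Decreasing Ai (dec i)) (below i li)
                                   (subst₂ _Lists_ (vals-just l r li) Ai (values i))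
      in trans hi (trans (cong just (sym h′≡h)) (sym li)) , subst (forestVals i r Lists_) (sym ti) rest
    ... | unmarked _ hi ti | unmarked _ li =
      trans hi (sym li) , subst₂ _Lists_ (vals-nothing l r li) (sym ti) (values i)
    ... | marked πi _ _ _ | unmarked πi′ _ with () ← trans (sym πi) πi′
    ... | unmarked πi _ _ | marked πi′ _ with () ← trans (sym πi) πi′

  -- Among the children, the mask of coordinate i chooses which of its prescribed values go to the subtree
  -- of the first child.
  firstPart restPart : Vec (List Bool) d → (Fin d → List ℕ) → Fin d → List ℕ
  firstPart v S i = select (lookup v i) (S i)
  restPart  v S i = select (map not (lookup v i)) (S i)

  HasCounts : (Fin d → ℕ) → (Fin d → ℕ) → Vec (List Bool) d → Set
  HasCounts a b v = ∀ i → trues (lookup v i) ≡ a i × falses (lookup v i) ≡ b i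

  module _ {a b : Fin d → ℕ} (v : Vec (List Bool) d) (S : Fin d → List ℕ) where

    length-mask : HasCounts a b v → (∀ i → length (S i) ≡ a i + b i) → ∀ i → length (lookup v i) ≡ length (S i)
    length-mask counts len i = begin
      length (lookup v i)                         ≡⟨ length≡trues+falses (lookup v i) ⟩
      trues (lookup v i) + falses (lookup v i)    ≡⟨ cong₂ _+_ (proj₁ (counts i)) (proj₂ (counts i)) ⟩
      a i + b i                                   ≡⟨ sym (len i) ⟩
      length (S i)                                ∎
      where open ≡-Reasoning

    length-firstPart : HasCounts a b v → (∀ i → length (S i) ≡ a i + b i) → ∀ i → length (firstPart v S i) ≡ a i
    length-firstPart counts len i =
      trans (length-select (lookup v i) (S i) (length-mask counts len i)) (proj₁ (counts i))

    length-restPart : HasCounts a b v → (∀ i → length (S i) ≡ a i + b i) → ∀ i → length (restPart v S i) ≡ b i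
    length-restPart counts len i =
      trans (length-select-not (lookup v i) (S i) (length-mask counts len i)) (proj₂ (counts i))

  Decreasing-firstPart : ∀ v S → (∀ i → Decreasing (S i)) → ∀ i → Decreasing (firstPart v S i)
  Decreasing-firstPart v S dec i = AllPairs-resp-⊆ (select-⊆ (lookup v i) (S i)) (dec i)

  Decreasing-restPart : ∀ v S → (∀ i → Decreasing (S i)) → ∀ i → Decreasing (restPart v S i)
  Decreasing-restPart v S dec i = AllPairs-resp-⊆ (select-⊆ (map not (lookup v i)) (S i)) (dec i)

  IsSplitLabelling : Subset d → Tree d → List (Subset d × Tree d) → (Fin d → List ℕ) →
    Vec (List Bool) d × LTree d × List (Subset d × LTree d) → Set
  IsSplitLabelling π t cs S p =
    HasCounts (λ i → indic i π + cnt i t) (λ i → cntL i cs) (proj₁ p) ×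
    IsLabelling π (firstPart (proj₁ p) S) t (proj₁ (proj₂ p)) ×
    IsForestLabelling (restPart (proj₁ p) S) cs (proj₂ (proj₂ p))

  attach : Subset d → Vec (List Bool) d × LTree d × List (Subset d × LTree d) → List (Subset d × LTree d)
  attach π (_ , c , r) = (π , c) ∷ r

  forestLabelling-∷ : ∀ π t cs S p → (∀ i → Decreasing (S i)) → (∀ i → length (S i) ≡ cntL i ((π , t) ∷ cs)) →
    IsSplitLabelling π t cs S p → IsForestLabelling S ((π , t) ∷ cs) (attach π p)
  forestLabelling-∷ π t cs S (v , c , r) dec len (counts , cLab , rLab) = record
    { shapes≡  = cong₂ (λ t′ cs′ → (π , t′) ∷ cs′)
                   (IsLabelling.shape≡ cLab) (IsForestLabelling.shapes≡ rLab)
    ; directed = (IsLabelling.rootDir cLab , IsLabelling.dirOK cLab) ∷ IsForestLabelling.directed rLab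
    ; descOKs  = IsLabelling.descOK cLab ∷ IsForestLabelling.descOKs rLab
    ; values   = λ i → subst (_Lists S i) (sym (forestVals-∷ i π c r))
                   (Lists-++ (lookup v i) (Decreasing⇒Unique (dec i)) (length-mask v S counts len i)
                      (IsLabelling.values cLab i) (IsForestLabelling.values rLab i))
    }

  forestLabelling-∷⁻ : ∀ π t cs S lcs → (∀ i → Decreasing (S i)) → IsForestLabelling S ((π , t) ∷ cs) lcs →
    ∃ λ p → IsSplitLabelling π t cs S p × attach π p ≡ lcs
  forestLabelling-∷⁻ π t cs S ((π′ , c) ∷ r) dec F with IsForestLabelling.shapes≡ F
  ... | refl = (v , c , r) , (counts , cLab , rLab) , refl
    where
    open IsForestLabelling F
    mask : Fin d → List Bool
    mask i = maskOf _≟_ (vals i c) (S i)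
    v : Vec (List Bool) d
    v = tabulate mask
    parts : ∀ i → vals i c Lists firstPart v S i × forestVals i r Lists restPart v S i
    parts i = subst (λ bs → vals i c Lists select bs (S i) × forestVals i r Lists select (map not bs) (S i))
                (sym (lookup∘tabulate mask i))
                (Lists-++⁻ _≟_ (vals i c) (subst (_Lists S i) (forestVals-∷ i π c r) (values i)))
    mask-length : ∀ i → length (lookup v i) ≡ length (S i)
    mask-length i = trans (cong length (lookup∘tabulate mask i)) (length-map _ (S i))
    counts : HasCounts (λ i → indic i π + cnt i (shape c)) (λ i → cntL i (shapeL r)) v
    counts i =
      trans (Lists-select⇒trues (lookup v i) (Decreasing⇒Unique (dec i)) (mask-length i) (proj₁ (parts i)))
            (length-vals i π c (All.head directed)) ,
      trans (Lists-select⇒falses (lookup v i) (Decreasing⇒Unique (dec i)) (mask-length i) (proj₂ (parts i)))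
            (length-forestVals i r (All.tail directed))
    cLab : IsLabelling π (firstPart v S) (shape c) c
    cLab = record { shape≡ = refl ; rootDir = proj₁ (All.head directed) ; dirOK = proj₂ (All.head directed)
                  ; descOK = All.head descOKs ; values = λ i → proj₁ (parts i) }
    rLab : IsForestLabelling (restPart v S) (shapeL r) r
    rLab = record { shapes≡ = refl ; directed = All.tail directed ; descOKs = All.tail descOKs
                  ; values = λ i → proj₂ (parts i) }

  attach-injective : ∀ π t cs S → (∀ i → Decreasing (S i)) → (∀ i → length (S i) ≡ cntL i ((π , t) ∷ cs)) →
    ∀ {p q} → IsSplitLabelling π t cs S p → IsSplitLabelling π t cs S q → attach π p ≡ attach π q → p ≡ q
  attach-injective π t cs S dec len {v , c , r} {v′ , _ , _} (counts , cLab , _) (counts′ , cLab′ , _) refl =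
    cong (λ v → v , c , r) (lookup-extensionality λ i →
      select-injective (lookup v i) (lookup v′ i) (Decreasing⇒Unique (dec i))
        (length-mask v S counts len i) (length-mask v′ S counts′ len i)
        (⇔-trans (⇔-sym (proj₂ (IsLabelling.values cLab i))) (proj₂ (IsLabelling.values cLab′ i))))

  binomial : Fin d → Subset d → Tree d → List (Subset d × Tree d) → ℕ
  binomial i π t cs = cntL i ((π , t) ∷ cs) C (indic i π + cnt i t)

  enumeration-splits : ∀ π t cs S → (∀ i → Decreasing (S i)) → (∀ i → length (S i) ≡ cntL i ((π , t) ∷ cs)) →
    ∀ {nt ncs} →
    (∀ A → (∀ i → Decreasing (A i)) → (∀ i → length (A i) ≡ indic i π + cnt i t) → Enumeration (IsLabelling π A t) nt) →
    (∀ S′ → (∀ i → Decreasing (S′ i)) → (∀ i → length (S′ i) ≡ cntL i cs) → Enumeration (IsForestLabelling S′ cs) ncs) →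
    Enumeration (IsSplitLabelling π t cs S) (prodFin d (λ i → binomial i π t cs) * (nt * ncs))
  enumeration-splits π t cs S dec len enumT enumF =
    enumeration-Σ
      (λ {v} counts → enumeration-Σ
        (λ _ → enumF (restPart v S) (Decreasing-restPart v S dec) (length-restPart v S counts len))
        (enumT (firstPart v S) (Decreasing-firstPart v S dec) (length-firstPart v S counts len)))
      (enumeration-Vec d (λ i → enumeration-masks (indic i π + cnt i t) (cntL i cs)))

  -- linExt i t is the number of linear extensions of the forest formed by the vertices of t whose direction
  -- contains i.
  mutual
    linExt : Fin d → Tree d → ℕ
    linExt i (node cs) = linExtL i cs

    linExtL : Fin d → List (Subset d × Tree d) → ℕ
    linExtL i []             = 1
    linExtL i ((π , t) ∷ cs) = binomial i π t cs * linExt i t * linExtL i cs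

  lnode-injective : ∀ {l : Label d} {r r′} → lnode l r ≡ lnode l r′ → r ≡ r′
  lnode-injective refl = refl

  prodFin-linExtL-∷ : ∀ π t cs →
    prodFin d (λ i → binomial i π t cs) * (prodFin d (λ i → linExt i t) * prodFin d (λ i → linExtL i cs))
    ≡ prodFin d (λ i → linExtL i ((π , t) ∷ cs))
  prodFin-linExtL-∷ π t cs = begin
    masks# * (first# * rest#)                                   ≡⟨ sym (*-assoc masks# first# rest#) ⟩
    masks# * first# * rest#                                     ≡⟨ cong (_* rest#) (sym (prodFin-* d _ _)) ⟩
    prodFin d (λ i → binomial i π t cs * linExt i t) * rest#   ≡⟨ sym (prodFin-* d _ _) ⟩
    prodFin d (λ i → linExtL i ((π , t) ∷ cs))                 ∎
    where
    open ≡-Reasoning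
    masks# first# rest# : ℕ
    masks# = prodFin d (λ i → binomial i π t cs)
    first# = prodFin d (λ i → linExt i t)
    rest# = prodFin d (λ i → linExtL i cs)

  mutual
    enumerate-labellings : ∀ π t A → (∀ i → Decreasing (A i)) → (∀ i → length (A i) ≡ indic i π + cnt i t) →
      Enumeration (IsLabelling π A t) (prodFin d (λ i → linExt i t))
    enumerate-labellings π (node tcs) A dec len =
      enumeration-map (lnode (headLabel π A)) (λ _ _ → lnode-injective)
        (labelling-node π tcs A _ dec len) (labelling-node⁻ π tcs A _ dec len)
        (enumerate-forestLabellings tcs (dropHeads π A)
          (λ i → Decreasing-dropHeads π A i (dec i) (len i)) (λ i → length-dropHeads π A i (len i)))

    enumerate-forestLabellings : ∀ cs S → (∀ i → Decreasing (S i)) → (∀ i → length (S i) ≡ cntL i cs) →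
      Enumeration (IsForestLabelling S cs) (prodFin d (λ i → linExtL i cs))
    enumerate-forestLabellings [] S dec len =
      enumeration ([] ∷ []) ([] ∷ [])
        (mk⇔ (λ { (here refl) → record { shapes≡ = refl ; directed = [] ; descOKs = []
                                       ; values = λ i → []-Lists (len i) } })
             (λ F → here (shapeL≡[] (IsForestLabelling.shapes≡ F))))
        (sym (product-map-1 (allFin d)))
      where
      shapeL≡[] : ∀ {r : List (Subset d × LTree d)} → shapeL r ≡ [] → r ≡ []
      shapeL≡[] {[]} _ = refl
    enumerate-forestLabellings ((π , t) ∷ cs) S dec len =
      subst (Enumeration _) (prodFin-linExtL-∷ π t cs)
        (enumeration-map (attach π) (attach-injective π t cs S dec len)
          (λ {p} → forestLabelling-∷ π t cs S p dec len) (forestLabelling-∷⁻ π t cs S _ dec)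
          (enumeration-splits π t cs S dec len (enumerate-labellings π t) (enumerate-forestLabellings cs)))

-- The hook length formula for forests

module _ {d : ℕ} where

  factorial-step : ∀ (i : Fin d) π n → (if lookup π i then 1 + n else 1) * n ! ≡ (indic i π + n) !
  factorial-step i π n with lookup π i
  ... | true  = refl
  ... | false = +-identityʳ (n !)

  mutual
    linExt-hook : ∀ i (t : Tree d) → linExt i t * prodE i t ≡ cnt i t !
    linExt-hook i (node cs) = linExtL-hook i cs

    linExtL-hook : ∀ i (cs : List (Subset d × Tree d)) → linExtL i cs * prodEL i cs ≡ cntL i cs !
    linExtL-hook i []             = refl
    linExtL-hook i ((π , t) ∷ cs) = begin
      (binom * linExt i t * linExtL i cs) * (e * prodE i t * prodEL i cs)
        ≡⟨ rearrange binom (linExt i t) (linExtL i cs) e (prodE i t) (prodEL i cs) ⟩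
      binom * ((e * (linExt i t * prodE i t)) * (linExtL i cs * prodEL i cs))
        ≡⟨ cong (binom *_) (cong₂ _*_ first-child (linExtL-hook i cs)) ⟩
      binom * ((indic i π + cnt i t) ! * cntL i cs !)
        ≡⟨ [m+n]Cm*m!*n!≡[m+n]! (indic i π + cnt i t) (cntL i cs) ⟩
      cntL i ((π , t) ∷ cs) ! ∎
      where
      open ≡-Reasoning
      binom e : ℕ
      binom = binomial i π t cs
      e = if lookup π i then 1 + cnt i t else 1
      first-child : e * (linExt i t * prodE i t) ≡ (indic i π + cnt i t) !
      first-child = trans (cong (e *_) (linExt-hook i t)) (factorial-step i π (cnt i t))
      rearrange : ∀ c t n e p q → (c * t * n) * (e * p * q) ≡ c * ((e * (t * p)) * (n * q))
      rearrange = solve-∀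

-- Non-ambiguous trees

CoordOK⇔Lists : ∀ {d} (i : Fin d) L {n} → length (vals i L) ≡ n → CoordOK i L ⇔ vals i L Lists interval n
CoordOK⇔Lists i L {n} len = mk⇔
  (λ (u , m , e) →
    let ≈m : vals i L Lists interval m
        ≈m = u , ⇔-trans (e _) (⇔-sym ∈-interval)
        n≡m : n ≡ m
        n≡m = trans (sym len)
                (trans (Lists⇒length≡ (Decreasing⇒Unique (Decreasing-interval m)) ≈m) (length-applyDownFrom suc m))
    in subst (λ m → vals i L Lists interval m) (sym n≡m) ≈m)
  (λ (u , e) → u , n , λ _ → ⇔-trans e ∈-interval)

indic-⊤ : ∀ {d} (i : Fin d) → indic i ⊤ ≡ 1
indic-⊤ i = cong (λ b → if b then 1 else 0) (lookup-replicate i true)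

IsNAT⇔IsLabelling : ∀ {d} (M : Tree d) L → IsNAT M L ⇔ IsLabelling ⊤ (λ i → interval (w i M)) M L
IsNAT⇔IsLabelling M L = mk⇔
  (λ (shape≡ , rootOK , dirOK , descOK , coordOK) →
    let rootDir = λ i → mk⇔ (λ _ → ∈⊤) (λ _ → rootOK i) in
    record { shape≡ = shape≡ ; rootDir = rootDir ; dirOK = dirOK ; descOK = descOK
           ; values = λ i → to (CoordOK⇔Lists i L (length-vals-⊤ shape≡ rootDir dirOK i)) (coordOK i) })
  (λ lab → let open IsLabelling lab in
    shape≡ , (λ i → from (rootDir i) ∈⊤) , dirOK , descOK ,
    λ i → from (CoordOK⇔Lists i L (length-vals-⊤ shape≡ rootDir dirOK i)) (values i))
  where
  length-vals-⊤ : shape L ≡ M → RootDirection ⊤ L → DirOK L → ∀ i → length (vals i L) ≡ w i M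
  length-vals-⊤ refl dir dirOK i = trans (length-vals i ⊤ L (dir , dirOK)) (cong (_+ cnt i (shape L)) (indic-⊤ i))

mainTheorem10 : (d k : ℕ) → 1 ≤ k → k ≤ d → (M : Tree d) → IsTreeDK k M →
    Σ (List (LTree d)) (λ NAT →
    Unique NAT × (∀ (L : LTree d) → (L ∈ NAT) ⇔ IsNAT M L) ×
    length NAT * prodFin d (λ i → prodE i M) ≡ prodFin d (λ i → (w i M ∸ 1) !))
mainTheorem10 d _ _ _ M _ =
  elements nats , unique nats , (λ L → ⇔-trans (∈⇔ nats) (⇔-sym (IsNAT⇔IsLabelling M L))) , count
  where
  nats : Enumeration (IsLabelling ⊤ (λ i → interval (w i M)) M) (prodFin d (λ i → linExt i M))
  nats = enumerate-labellings ⊤ M (λ i → interval (w i M)) (λ i → Decreasing-interval (w i M))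
           (λ i → trans (length-applyDownFrom suc (w i M)) (cong (_+ cnt i M) (sym (indic-⊤ i))))
  count : length (elements nats) * prodFin d (λ i → prodE i M) ≡ prodFin d (λ i → cnt i M !)
  count = begin
    length (elements nats) * prodFin d (λ i → prodE i M)
      ≡⟨ cong (_* prodFin d (λ i → prodE i M)) (length≡ nats) ⟩
    prodFin d (λ i → linExt i M) * prodFin d (λ i → prodE i M)
      ≡⟨ sym (prodFin-* d _ _) ⟩
    prodFin d (λ i → linExt i M * prodE i M)
      ≡⟨ prodFin-cong d (λ i → linExt-hook i M) ⟩
    prodFin d (λ i → cnt i M !) ∎
    where open ≡-Reasoning
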